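{- Let $m,n,k,i\in\mathbb{N}$ and $\xi=m\alpha_1+n\alpha_2+k\alpha_3$, and put $t=m+n+k-i$. Then the number of ways to express $\xi$ as a sum of exactly $i$ positive roots (i.e. the number of tuples $(a_\beta)_{\beta\in\Phi^+}\in\mathbb{N}^6$ with $\sum_\beta a_\beta\beta=\xi$ and $\sum_\beta a_\beta=i$) equals the number of triples $(d,e,f)\in\mathbb{N}^3$ with $d+e+2f=t$ satisfying $d+f\leq m$, $d+e+f\leq n$, and $e+f\leq k$.
   Context: For $\mathfrak{sl}_4(\mathbb{C})$, $\alpha_1,\alpha_2,\alpha_3$ are the (linearly independent) simple roots and the positive roots are $\Phi^+=\{\alpha_1,\alpha_2,\alpha_3,\alpha_1+\alpha_2,\alpha_2+\alpha_3,\alpha_1+\alpha_2+\alpha_3\}$. $\mathbb{N}=\{0,1,2,\ldots\}$. (A triple $(d,e,f)$ with $d+e+2f=t$ is what the paper calls a $\{1_r,1_b,2\}$-partition $d\cdot 1_r+e\cdot 1_b+f\cdot 2$ of $t$, i.e. a partition of $t$ into parts $1$ of two colors and parts $2$.) -}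

module Defs where

open import Data.Nat using (ℕ; zero; suc; _+_; _*_; _≤_; _≟_; _≤?_)
open import Data.List using (List; []; _∷_; map; concatMap; filter; length; upTo)
open import Data.Product using (_×_; _,_)
open import Relation.Binary.PropositionalEquality using (_≡_)
open import Relation.Nullary.Decidable using (Dec; _×-dec_)
open import Data.Product.Properties using (≡-dec)

-- Elements of the root lattice Zα₁ ⊕ Zα₂ ⊕ Zα₃ with nonnegative coefficients,
-- recorded by their coordinates in the (linearly independent) simple roots.
Wt : Set
Wt = ℕ × ℕ × ℕ

_⊕_ : Wt → Wt → Wt
(a , b , c) ⊕ (a' , b' , c') = (a + a' , b + b' , c + c')

_·_ : ℕ → Wt → Wt
n · (a , b , c) = (n * a , n * b , n * c)

α₁ α₂ α₃ α₁₂ α₂₃ α₁₂₃ : Wt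
α₁ = (1 , 0 , 0)
α₂ = (0 , 1 , 0)
α₃ = (0 , 0 , 1)
α₁₂ = (1 , 1 , 0)
α₂₃ = (0 , 1 , 1)
α₁₂₃ = (1 , 1 , 1)

-- a tuple (a_β)_{β∈Φ⁺} ∈ ℕ⁶, in the order α₁, α₂, α₃, α₁+α₂, α₂+α₃, α₁+α₂+α₃
Tuple6 : Set
Tuple6 = ℕ × ℕ × ℕ × ℕ × ℕ × ℕ

rootSum : Tuple6 → Wt
rootSum (a₁ , a₂ , a₃ , a₁₂ , a₂₃ , a₁₂₃) =
  (a₁ · α₁) ⊕ ((a₂ · α₂) ⊕ ((a₃ · α₃) ⊕ ((a₁₂ · α₁₂) ⊕ ((a₂₃ · α₂₃) ⊕ (a₁₂₃ · α₁₂₃)))))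

total : Tuple6 → ℕ
total (a₁ , a₂ , a₃ , a₁₂ , a₂₃ , a₁₂₃) = a₁ + a₂ + a₃ + a₁₂ + a₂₃ + a₁₂₃

upto : ℕ → List ℕ
upto N = upTo (suc N)

boxed6 : ℕ → List Tuple6
boxed6 N =
  concatMap (λ a → concatMap (λ b → concatMap (λ c → concatMap (λ d →
    concatMap (λ e → map (λ f → (a , b , c , d , e , f)) (upto N))
    (upto N)) (upto N)) (upto N)) (upto N)) (upto N)

boxed3 : ℕ → List (ℕ × ℕ × ℕ)
boxed3 N = concatMap (λ a → concatMap (λ b → map (λ c → (a , b , c)) (upto N)) (upto N)) (upto N)

_≟W_ : (x y : Wt) → Dec (x ≡ y)
_≟W_ = ≡-dec _≟_ (≡-dec _≟_ _≟_)

IsExpr : Wt → ℕ → Tuple6 → Set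
IsExpr ξ i a = (rootSum a ≡ ξ) × (total a ≡ i)

isExpr? : ∀ ξ i a → Dec (IsExpr ξ i a)
isExpr? ξ i a = (rootSum a ≟W ξ) ×-dec (total a ≟ i)

-- number of tuples (a_β) ∈ ℕ⁶ with Σ a_β β = ξ and Σ a_β = i.
-- Every such tuple has all entries ≤ i, so enumerating the box [0,i]⁶ is exhaustive.
numExpressions : Wt → ℕ → ℕ
numExpressions ξ i = length (filter (isExpr? ξ i) (boxed6 i))

-- the triple condition: d + e + 2f = t (written additively as d+e+2f+i = m+n+k,
-- so t = m+n+k-i is an honest integer; no triples exist when t < 0),
-- d + f ≤ m, d + e + f ≤ n, e + f ≤ k
IsTriple : ℕ → ℕ → ℕ → ℕ → ℕ × ℕ × ℕ → Set
IsTriple m n k i (d , e , f) =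
  (d + e + 2 * f + i ≡ m + n + k) × (d + f ≤ m) × (d + e + f ≤ n) × (e + f ≤ k)

isTriple? : ∀ m n k i x → Dec (IsTriple m n k i x)
isTriple? m n k i (d , e , f) =
  (d + e + 2 * f + i ≟ m + n + k) ×-dec ((d + f ≤? m) ×-dec ((d + e + f ≤? n) ×-dec (e + f ≤? k)))

-- number of triples (d,e,f) ∈ ℕ³ satisfying IsTriple; all entries ≤ m+n+k, so the box is exhaustive.
numTriples : ℕ → ℕ → ℕ → ℕ → ℕ
numTriples m n k i = length (filter (isTriple? m n k i) (boxed3 (m + n + k)))

-- An expression of ξ = mα₁ + nα₂ + kα₃ is determined by the multiplicities d, e, f of
-- α₁+α₂, α₂+α₃, α₁+α₂+α₃: the simple roots must supply the remaining m − d − f,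
-- n − d − e − f and k − e − f, which are nonnegative exactly under the three inequalities.
-- Comparing heights, such an expression has m + n + k − (d + e + 2f) parts.
module Submission where

open import Defs
open import Data.Nat using (ℕ; zero; suc; _+_; _*_; _∸_; _≤_; s≤s)
open import Data.Nat.Properties
  using (m≤m+n; m≤n+m; m≤n⇒m≤n+o; ≤-trans; +-cancelˡ-≡; m+n∸n≡m; m∸n+n≡m)
open import Data.Nat.Tactic.RingSolver using (solve-∀)
open import Data.List
  using (List; []; _∷_; _++_; map; concatMap; filter; length; cartesianProductWith; cartesianProduct)
open import Data.List.Properties using (length-map; map-∘; map-concatMap; concatMap-cong)
open import Data.List.Membership.Propositional using (_∈_)
open import Data.List.Membership.Propositional.Properties
  using (∈-map⁺; ∈-map⁻; ∈-filter⁺; ∈-filter⁻; ∈-upTo⁺; ∈-cartesianProduct⁺)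
open import Data.List.Membership.Propositional.Properties.WithK using (unique∧set⇒bag)
open import Data.List.Relation.Unary.Unique.Propositional using (Unique)
import Data.List.Relation.Unary.Unique.Propositional.Properties as Unique
open import Data.List.Relation.Binary.BagAndSetEquality using (∼bag⇒↭)
open import Data.List.Relation.Binary.Permutation.Propositional.Properties using (↭-length)
open import Data.Product using (_×_; _,_; ∃)
open import Function.Bundles using (mk⇔)
open import Relation.Binary.PropositionalEquality
open import Relation.Unary using (Decidable)

length-filter-≡-by-injection :
  {A B : Set} {P : A → Set} {Q : B → Set} (P? : Decidable P) (Q? : Decidable Q)
  {xs : List A} {ys : List B} (g : B → A) → (∀ {y y′} → g y ≡ g y′ → y ≡ y′) →
  Unique xs → Unique ys →
  (∀ {x} → x ∈ xs → P x → ∃ λ y → y ∈ ys × Q y × g y ≡ x) →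
  (∀ {y} → y ∈ ys → Q y → g y ∈ xs × P (g y)) →
  length (filter P? xs) ≡ length (filter Q? ys)
length-filter-≡-by-injection P? Q? {xs} {ys} g g-inj xs! ys! onto into =
  trans (↭-length (∼bag⇒↭ (unique∧set⇒bag (Unique.filter⁺ P? xs!)
                                          (Unique.map⁺ g-inj (Unique.filter⁺ Q? ys!))
                                          (mk⇔ covered landing))))
        (length-map g (filter Q? ys))
  where
  covered : ∀ {x} → x ∈ filter P? xs → x ∈ map g (filter Q? ys)
  covered x∈ with x∈xs , px ← ∈-filter⁻ P? x∈
             with y , y∈ys , qy , refl ← onto x∈xs px
    = ∈-map⁺ g (∈-filter⁺ Q? y∈ys qy)
  landing : ∀ {x} → x ∈ map g (filter Q? ys) → x ∈ filter P? xs
  landing x∈ with y , y∈ , refl ← ∈-map⁻ g x∈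
             with y∈ys , qy ← ∈-filter⁻ Q? y∈
             with gy∈xs , pgy ← into y∈ys qy
    = ∈-filter⁺ P? gy∈xs pgy

concatMap-map≡cartesianProductWith : {A B C : Set} (f : A → B → C) (xs : List A) (ys : List B) →
  concatMap (λ x → map (f x) ys) xs ≡ cartesianProductWith f xs ys
concatMap-map≡cartesianProductWith f []       ys = refl
concatMap-map≡cartesianProductWith f (x ∷ xs) ys =
  cong (map (f x) ys ++_) (concatMap-map≡cartesianProductWith f xs ys)

Tuple : ℕ → Set
Tuple zero    = ℕ
Tuple (suc n) = ℕ × Tuple n

-- box N 5 id and box N 2 id unfold to boxed6 N and boxed3 N.
box : ℕ → (n : ℕ) {C : Set} → (Tuple n → C) → List C
box N zero    k = map k (upto N)
box N (suc n) k = concatMap (λ a → box N n (λ r → k (a , r))) (upto N)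

Bounded : ℕ → (n : ℕ) → Tuple n → Set
Bounded N zero    a       = a ≤ N
Bounded N (suc n) (a , r) = a ≤ N × Bounded N n r

module _ (N : ℕ) where

  box-map : ∀ n {C D : Set} (g : C → D) (k : Tuple n → C) → box N n (λ r → g (k r)) ≡ map g (box N n k)
  box-map zero    g k = map-∘ (upto N)
  box-map (suc n) g k = begin
    concatMap (λ a → box N n (λ r → g (k (a , r)))) (upto N)
      ≡⟨ concatMap-cong (λ a → box-map n g (λ r → k (a , r))) (upto N) ⟩
    concatMap (λ a → map g (box N n (λ r → k (a , r)))) (upto N)
      ≡⟨ map-concatMap g _ (upto N) ⟨
    map g (box N (suc n) k) ∎
    where open ≡-Reasoning

  box-suc : ∀ n → box N (suc n) (λ x → x) ≡ cartesianProduct (upto N) (box N n (λ x → x))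
  box-suc n = begin
    concatMap (λ a → box N n (λ r → (a , r))) (upto N)
      ≡⟨ concatMap-cong (λ a → box-map n (a ,_) (λ r → r)) (upto N) ⟩
    concatMap (λ a → map (a ,_) (box N n (λ r → r))) (upto N)
      ≡⟨ concatMap-map≡cartesianProductWith _,_ (upto N) _ ⟩
    cartesianProduct (upto N) (box N n (λ r → r)) ∎
    where open ≡-Reasoning

  box-unique : ∀ n → Unique (box N n (λ x → x))
  box-unique zero    = Unique.map⁺ (λ eq → eq) (Unique.upTo⁺ (suc N))
  box-unique (suc n) rewrite box-suc n =
    Unique.cartesianProduct⁺ (Unique.upTo⁺ (suc N)) (box-unique n)

  ∈-box : ∀ n {x} → Bounded N n x → x ∈ box N n (λ x → x)
  ∈-box zero    a≤N = ∈-map⁺ (λ x → x) (∈-upTo⁺ (s≤s a≤N))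
  ∈-box (suc n) (a≤N , r≤N) rewrite box-suc n =
    ∈-cartesianProduct⁺ (∈-upTo⁺ (s≤s a≤N)) (∈-box n r≤N)

rootSum-coordinates : ∀ a₁ a₂ a₃ d e f →
  rootSum (a₁ , a₂ , a₃ , d , e , f) ≡ (a₁ + (d + f) , a₂ + (d + e + f) , a₃ + (e + f))
rootSum-coordinates a₁ a₂ a₃ d e f =
  cong₂ _,_ (first a₁ a₂ a₃ d e f) (cong₂ _,_ (second a₁ a₂ a₃ d e f) (third a₁ a₂ a₃ d e f))
  where
  first : ∀ a₁ a₂ a₃ d e f →
    a₁ * 1 + (a₂ * 0 + (a₃ * 0 + (d * 1 + (e * 0 + f * 1)))) ≡ a₁ + (d + f)
  first = solve-∀
  second : ∀ a₁ a₂ a₃ d e f →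
    a₁ * 0 + (a₂ * 1 + (a₃ * 0 + (d * 1 + (e * 1 + f * 1)))) ≡ a₂ + (d + e + f)
  second = solve-∀
  third : ∀ a₁ a₂ a₃ d e f →
    a₁ * 0 + (a₂ * 0 + (a₃ * 1 + (d * 0 + (e * 1 + f * 1)))) ≡ a₃ + (e + f)
  third = solve-∀

height-excess : ∀ a₁ a₂ a₃ d e f →
  d + e + 2 * f + (a₁ + a₂ + a₃ + d + e + f) ≡ (a₁ + (d + f)) + (a₂ + (d + e + f)) + (a₃ + (e + f))
height-excess = solve-∀

expressionOf : ℕ → ℕ → ℕ → ℕ × ℕ × ℕ → Tuple6
expressionOf m n k (d , e , f) = (m ∸ (d + f) , n ∸ (d + e + f) , k ∸ (e + f) , d , e , f)

expressionOf-injective : ∀ m n k {t t′} → expressionOf m n k t ≡ expressionOf m n k t′ → t ≡ t′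
expressionOf-injective m n k {_ , _ , _} {_ , _ , _} refl = refl

expression⇒triple : ∀ {m n k i} a → IsExpr (m , n , k) i a →
  ∃ λ t → IsTriple m n k i t × expressionOf m n k t ≡ a
expression⇒triple (a₁ , a₂ , a₃ , d , e , f) (sum≡ , refl)
  with refl ← trans (sym (rootSum-coordinates a₁ a₂ a₃ d e f)) sum≡ =
  (d , e , f) ,
  (height-excess a₁ a₂ a₃ d e f , m≤n+m _ a₁ , m≤n+m _ a₂ , m≤n+m _ a₃) ,
  cong₂ _,_ (m+n∸n≡m a₁ (d + f)) (cong₂ _,_ (m+n∸n≡m a₂ (d + e + f)) (cong (_, d , e , f) (m+n∸n≡m a₃ (e + f))))

triple⇒expression : ∀ {m n k i} t → IsTriple m n k i t → IsExpr (m , n , k) i (expressionOf m n k t)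
triple⇒expression {m} {n} {k} {i} (d , e , f) (t+i≡ , d+f≤m , d+e+f≤n , e+f≤k) = sum≡ , total≡
  where
  a₁ = m ∸ (d + f)
  a₂ = n ∸ (d + e + f)
  a₃ = k ∸ (e + f)
  coordinates : (a₁ + (d + f) , a₂ + (d + e + f) , a₃ + (e + f)) ≡ (m , n , k)
  coordinates = cong₂ _,_ (m∸n+n≡m d+f≤m) (cong₂ _,_ (m∸n+n≡m d+e+f≤n) (m∸n+n≡m e+f≤k))
  sum≡ : rootSum (a₁ , a₂ , a₃ , d , e , f) ≡ (m , n , k)
  sum≡ = trans (rootSum-coordinates a₁ a₂ a₃ d e f) coordinates
  total≡ : a₁ + a₂ + a₃ + d + e + f ≡ i
  total≡ = +-cancelˡ-≡ (d + e + 2 * f) _ _ (begin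
    d + e + 2 * f + (a₁ + a₂ + a₃ + d + e + f)
      ≡⟨ height-excess a₁ a₂ a₃ d e f ⟩
    (a₁ + (d + f)) + (a₂ + (d + e + f)) + (a₃ + (e + f))
      ≡⟨ cong (λ { (x , y , z) → x + y + z }) coordinates ⟩
    m + n + k
      ≡⟨ t+i≡ ⟨
    d + e + 2 * f + i ∎)
    where open ≡-Reasoning

expression-bounded : ∀ a → Bounded (total a) 5 a
expression-bounded (a₁ , a₂ , a₃ , d , e , f) =
  m≤n⇒m≤n+o f (m≤n⇒m≤n+o e (m≤n⇒m≤n+o d (m≤n⇒m≤n+o a₃ (m≤m+n a₁ a₂)))) ,
  m≤n⇒m≤n+o f (m≤n⇒m≤n+o e (m≤n⇒m≤n+o d (m≤n⇒m≤n+o a₃ (m≤n+m a₂ a₁)))) ,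
  m≤n⇒m≤n+o f (m≤n⇒m≤n+o e (m≤n⇒m≤n+o d (m≤n+m a₃ (a₁ + a₂)))) ,
  m≤n⇒m≤n+o f (m≤n⇒m≤n+o e (m≤n+m d (a₁ + a₂ + a₃))) ,
  m≤n⇒m≤n+o f (m≤n+m e (a₁ + a₂ + a₃ + d)) ,
  m≤n+m f (a₁ + a₂ + a₃ + d + e)

triple-bounded : ∀ {m n k i} t → IsTriple m n k i t → Bounded (m + n + k) 2 t
triple-bounded {m} {n} {k} (d , e , f) (_ , _ , d+e+f≤n , _) =
  ≤-trans (m≤n⇒m≤n+o f (m≤m+n d e)) n-bound ,
  ≤-trans (m≤n⇒m≤n+o f (m≤n+m e d)) n-bound ,
  ≤-trans (m≤n+m f (d + e)) n-bound
  where
  n-bound : d + e + f ≤ m + n + k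
  n-bound = ≤-trans d+e+f≤n (m≤n⇒m≤n+o k (m≤n+m n m))

proposition2 : (m n k i : ℕ) →
    numExpressions (m , n , k) i ≡ numTriples m n k i
proposition2 m n k i =
  length-filter-≡-by-injection (isExpr? (m , n , k) i) (isTriple? m n k i)
    (expressionOf m n k) (expressionOf-injective m n k)
    (box-unique i 5) (box-unique (m + n + k) 2) onto into
  where
  onto : ∀ {a} → a ∈ boxed6 i → IsExpr (m , n , k) i a →
    ∃ λ t → t ∈ boxed3 (m + n + k) × IsTriple m n k i t × expressionOf m n k t ≡ a
  onto {a} _ isExpr with t , isTriple , refl ← expression⇒triple a isExpr =
    t , ∈-box (m + n + k) 2 (triple-bounded t isTriple) , isTriple , refl
  into : ∀ {t} → t ∈ boxed3 (m + n + k) → IsTriple m n k i t →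
    expressionOf m n k t ∈ boxed6 i × IsExpr (m , n , k) i (expressionOf m n k t)
  into {t} _ isTriple with isExpr@(_ , refl) ← triple⇒expression t isTriple =
    ∈-box i 5 (expression-bounded (expressionOf m n k t)) , isExpr
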